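{- Let $m,n\in\mathbb{N}$. Let $\vec{K}_{m,m}$ be the complete bipartite digraph with vertex set $V=V_1\cup V_2$, $V_1=\{v_1^{(1)},\dots,v_m^{(1)}\}$, $V_2=\{v_1^{(2)},\dots,v_m^{(2)}\}$, and edge set $V_1\times V_2$. Let $\gamma$ be a monotone $(n+1)$-coloring of $\vec{K}_{m,m}$. Let $\mathfrak{a}=(A,=)$ be an antichain with $A=\{a_1,\dots,a_m\}$ and $\mathfrak{c}=(C,\le)$ a chain with $C=\{c_1,\dots,c_n\}$ (disjoint from $A$), $c_i\le c_j\iff i\le j$. Define $R_\gamma\subseteq A\times C$ and $S_\gamma\subseteq C\times A$ by \[ a_i\,R_\gamma\,c_j\iff \gamma(v_i^{(1)})=k\text{ and } n+2-k\le j\le n,\qquad c_j\,S_\gamma\,a_i\iff \gamma(v_i^{(2)})=k\text{ and } 1\le j\le n+1-k, \] for $1\le i\le m$, $1\le j\le n$. Then $(R_\gamma,S_\gamma)$ is a proper merging of $\mathfrak{a}$ and $\mathfrak{c}$.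
   Context: A $k$-coloring of a digraph $(V,\vec E)$ is a map $\gamma:V\to\{1,\dots,k\}$; it is monotone if $(v,w)\in\vec E$ implies $\gamma(v)\le\gamma(w)$. An antichain $(A,=)$ is a set ordered by equality. A quasi-order is a reflexive, transitive binary relation. For disjoint quasi-ordered sets $(P,\leftarrow_P)$, $(Q,\leftarrow_Q)$ and relations $R\subseteq P\times Q$, $S\subseteq Q\times P$, define $\leftarrow_{R,S}$ on $P\cup Q$ by: $p\leftarrow_{R,S}q$ iff $p\leftarrow_P q$ or $p\leftarrow_Q q$ or $(p,q)\in R$ or $(p,q)\in S$. $(R,S)$ is a merging of $P$ and $Q$ if $\leftarrow_{R,S}$ is a quasi-order on $P\cup Q$, and a proper merging if additionally $R\cap S^{ -1}=\emptyset$. -}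

module Defs where

open import Level using (Level; _⊔_)
open import Data.Nat using (ℕ; suc; _+_; _∸_; _≤_)
open import Data.Fin using (Fin; toℕ)
open import Data.Sum using (_⊎_; inj₁; inj₂)
open import Data.Product using (_×_)
open import Data.Empty using (⊥)
open import Relation.Binary.PropositionalEquality using (_≡_)
open import Relation.Binary.Definitions using (Reflexive; Transitive)

-- A digraph is a vertex type with an edge relation.
-- A (k)-coloring is a map into Fin k; colour value of v is 1 + toℕ (γ v) ∈ {1..k}.
colourValue : ∀ {k} → Fin k → ℕ
colourValue c = suc (toℕ c)

Monotone : ∀ {a e} {V : Set a} (E : V → V → Set e) {k : ℕ} (γ : V → Fin k) → Set (a ⊔ e)
Monotone E γ = ∀ {v w} → E v w → colourValue (γ v) ≤ colourValue (γ w)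

-- complete bipartite digraph K⃗_{m,m}: vertices V₁ ⊎ V₂ (inj₁ i = v_{i+1}^{(1)},
-- inj₂ i = v_{i+1}^{(2)}), edge set V₁ × V₂.
KVert : ℕ → Set
KVert m = Fin m ⊎ Fin m

data KEdge (m : ℕ) : KVert m → KVert m → Set where
  edge : (i j : Fin m) → KEdge m (inj₁ i) (inj₂ j)

IsQuasiOrder : ∀ {a ℓ} {X : Set a} → (X → X → Set ℓ) → Set (a ⊔ ℓ)
IsQuasiOrder _∼_ = Reflexive _∼_ × Transitive _∼_

data MergedRel {p q ℓ₁ ℓ₂ ℓ₃ ℓ₄} {P : Set p} {Q : Set q}
       (_←P_ : P → P → Set ℓ₁) (_←Q_ : Q → Q → Set ℓ₂)
       (R : P → Q → Set ℓ₃) (S : Q → P → Set ℓ₄)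
       : P ⊎ Q → P ⊎ Q → Set (p ⊔ q ⊔ ℓ₁ ⊔ ℓ₂ ⊔ ℓ₃ ⊔ ℓ₄) where
  inP : ∀ {x y} → x ←P y → MergedRel _←P_ _←Q_ R S (inj₁ x) (inj₁ y)
  inQ : ∀ {x y} → x ←Q y → MergedRel _←P_ _←Q_ R S (inj₂ x) (inj₂ y)
  inR : ∀ {x y} → R x y → MergedRel _←P_ _←Q_ R S (inj₁ x) (inj₂ y)
  inS : ∀ {x y} → S x y → MergedRel _←P_ _←Q_ R S (inj₂ x) (inj₁ y)

IsMerging : ∀ {p q ℓ₁ ℓ₂ ℓ₃ ℓ₄} {P : Set p} {Q : Set q}
       (_←P_ : P → P → Set ℓ₁) (_←Q_ : Q → Q → Set ℓ₂)
       (R : P → Q → Set ℓ₃) (S : Q → P → Set ℓ₄) → Set _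
IsMerging _←P_ _←Q_ R S = IsQuasiOrder (MergedRel _←P_ _←Q_ R S)

IsProperMerging : ∀ {p q ℓ₁ ℓ₂ ℓ₃ ℓ₄} {P : Set p} {Q : Set q}
       (_←P_ : P → P → Set ℓ₁) (_←Q_ : Q → Q → Set ℓ₂)
       (R : P → Q → Set ℓ₃) (S : Q → P → Set ℓ₄) → Set _
IsProperMerging _←P_ _←Q_ R S =
  IsMerging _←P_ _←Q_ R S × (∀ x y → R x y → S y x → ⊥)

-- antichain 𝔞 = (Fin m, ≡): inhabitant i stands for a_{i+1}
-- chain 𝔠 = (Fin n, ≤ on indices): inhabitant j stands for c_{j+1}
ChainLe : ∀ {n} → Fin n → Fin n → Set
ChainLe i j = toℕ i ≤ toℕ j

Rγ : ∀ {m n} → (KVert m → Fin (suc n)) → Fin m → Fin n → Set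
Rγ {m} {n} γ i j =
  (n + 2 ∸ colourValue (γ (inj₁ i)) ≤ suc (toℕ j)) × (suc (toℕ j) ≤ n)

Sγ : ∀ {m n} → (KVert m → Fin (suc n)) → Fin n → Fin m → Set
Sγ {m} {n} γ j i =
  (1 ≤ suc (toℕ j)) × (suc (toℕ j) ≤ n + 1 ∸ colourValue (γ (inj₂ i)))

-- The merged relation is a quasi-order as soon as R and S are compatible with
-- the orders on both sides, every R∘S path stays inside P and every S∘R path
-- inside Q. For R_γ and S_γ the chain-side compatibility is immediate from the
-- interval shape of their definitions. The composites are governed by the gap
-- (n+1) − γ(v⁽²⁾) < (n+2) − γ(v⁽¹⁾), which monotonicity of γ along the edges
-- V₁ × V₂ provides for every pair of vertices: it makes an R∘S path
-- impossible (this is also properness) and forces c_j < c_j' along S∘R.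
module Submission where

open import Defs
open import Data.Nat using (ℕ; suc; _+_; _∸_; _≤_; _<_; s≤s; z≤n)
open import Data.Nat.Properties
open import Data.Fin using (Fin; toℕ)
open import Data.Fin.Properties using (toℕ<n)
open import Data.Sum using (inj₁; inj₂)
open import Data.Product using (_,_)
open import Data.Empty using (⊥; ⊥-elim)
open import Relation.Binary.PropositionalEquality using (_≡_; refl; sym; trans)

module _ {p q ℓ₁ ℓ₂ ℓ₃ ℓ₄} {P : Set p} {Q : Set q}
         {_←P_ : P → P → Set ℓ₁} {_←Q_ : Q → Q → Set ℓ₂}
         {R : P → Q → Set ℓ₃} {S : Q → P → Set ℓ₄} where

  isMerging : IsQuasiOrder _←P_ → IsQuasiOrder _←Q_ →
    (∀ {x y z} → x ←P y → R y z → R x z) →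
    (∀ {x y z} → R x y → y ←Q z → R x z) →
    (∀ {x y z} → x ←Q y → S y z → S x z) →
    (∀ {x y z} → S x y → y ←P z → S x z) →
    (∀ {x y z} → R x y → S y z → x ←P z) →
    (∀ {x y z} → S x y → R y z → x ←Q z) →
    IsMerging _←P_ _←Q_ R S
  isMerging (reflP , transP) (reflQ , transQ) P-R R-Q Q-S S-P R-S S-R =
    reflexive , transitive
    where
    reflexive : ∀ {x} → MergedRel _←P_ _←Q_ R S x x
    reflexive {inj₁ _} = inP reflP
    reflexive {inj₂ _} = inQ reflQ

    transitive : ∀ {x y z} → MergedRel _←P_ _←Q_ R S x y →
                 MergedRel _←P_ _←Q_ R S y z → MergedRel _←P_ _←Q_ R S x z
    transitive (inP a) (inP b) = inP (transP a b)
    transitive (inP a) (inR b) = inR (P-R a b)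
    transitive (inQ a) (inQ b) = inQ (transQ a b)
    transitive (inQ a) (inS b) = inS (Q-S a b)
    transitive (inR a) (inQ b) = inR (R-Q a b)
    transitive (inR a) (inS b) = inP (R-S a b)
    transitive (inS a) (inP b) = inS (S-P a b)
    transitive (inS a) (inR b) = inQ (S-R a b)

∸-<-suc-∸ : ∀ {a k l} → k ≤ l → l ≤ a → a ∸ l < suc a ∸ k
∸-<-suc-∸ {a} {k} {l} k≤l l≤a = begin-strict
  a ∸ l         <⟨ n<1+n (a ∸ l) ⟩
  suc (a ∸ l)   ≡⟨ sym (+-∸-assoc 1 l≤a) ⟩
  suc a ∸ l     ≤⟨ ∸-monoʳ-≤ (suc a) k≤l ⟩
  suc a ∸ k     ∎
  where open ≤-Reasoning

module _ {m n : ℕ} {γ : KVert m → Fin (suc n)} (mono : Monotone (KEdge m) γ) where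

  colour-gap : ∀ i i′ → n + 1 ∸ colourValue (γ (inj₂ i′)) < n + 2 ∸ colourValue (γ (inj₁ i))
  colour-gap i i′ rewrite +-suc n 1 =
    ∸-<-suc-∸ (mono (edge i i′)) (≤-trans (toℕ<n (γ (inj₂ i′))) (≤-reflexive (+-comm 1 n)))

  Rγ-Sγ-disjoint : ∀ {i j i′} → Rγ γ i j → Sγ γ j i′ → ⊥
  Rγ-Sγ-disjoint {i} {i′ = i′} (r , _) (_ , s) = <⇒≱ (colour-gap i i′) (≤-trans r s)

  Sγ-Rγ-increasing : ∀ {j i j′} → Sγ γ j i → Rγ γ i j′ → toℕ j < toℕ j′
  Sγ-Rγ-increasing {i = i} (_ , s) (r , _) = ≤-pred (≤-<-trans s (<-≤-trans (colour-gap i i) r))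

Rγ-upward : ∀ {m n} {γ : KVert m → Fin (suc n)} {i j j′} →
            Rγ γ i j → ChainLe j j′ → Rγ γ i j′
Rγ-upward (r , _) j≤j′ = ≤-trans r (s≤s j≤j′) , toℕ<n _

Sγ-downward : ∀ {m n} {γ : KVert m → Fin (suc n)} {j′ j i} →
              ChainLe j′ j → Sγ γ j i → Sγ γ j′ i
Sγ-downward j′≤j (_ , s) = s≤s z≤n , ≤-trans (s≤s j′≤j) s

lemma5p5 : (m n : ℕ) (γ : KVert m → Fin (suc n)) → Monotone (KEdge m) γ →
    IsProperMerging {P = Fin m} {Q = Fin n} _≡_ ChainLe (Rγ γ) (Sγ γ)
lemma5p5 m n γ mono =
  isMerging (refl , trans) (≤-refl , ≤-trans)
    (λ { refl r → r }) (Rγ-upward {γ = γ}) (Sγ-downward {γ = γ}) (λ { s refl → s })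
    (λ r s → ⊥-elim (Rγ-Sγ-disjoint mono r s))
    (λ s r → <⇒≤ (Sγ-Rγ-increasing mono s r))
  , λ _ _ → Rγ-Sγ-disjoint mono
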